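{- There exists a countable family $\mathcal{F}=\{f_n : n\in\omega\}$ of continuous functions $f_n\colon 2^\omega\to 2^\omega$ such that every maximal (with respect to inclusion) set $S\subseteq 2^\omega$ whose square $S\times S$ is covered by $\mathcal{F}$ is uncountable.
   Context: $2^\omega$ denotes the Cantor set (the space of all zero-one sequences indexed by $\omega$, with the product topology). A set $M\subseteq 2^\omega\times 2^\omega$ is said to be covered by a family of functions $\mathcal{F}$ if for every $(x,y)\in M$ there is $f\in\mathcal{F}$ such that either $y=f(x)$ or $x=f(y)$. A maximal set whose square is covered by $\mathcal{F}$ is a set $S\subseteq 2^\omega$ such that $S\times S$ is covered by $\mathcal{F}$ and no proper superset $S'\supsetneq S$ in $2^\omega$ has $S'\times S'$ covered by $\mathcal{F}$. -}

module Defs where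

open import Data.Nat using (ℕ; _<_)
open import Data.Bool using (Bool)
open import Data.Product using (Σ; ∃; _×_)
open import Data.Sum using (_⊎_)
open import Relation.Nullary using (¬_)
open import Relation.Binary.PropositionalEquality using (_≡_)
open import Level using (0ℓ; suc)

Cantor : Set
Cantor = ℕ → Bool

_≈_ : Cantor → Cantor → Set
x ≈ y = ∀ i → x i ≡ y i

-- Agreement on the first m coordinates (basic clopen neighbourhoods).
AgreeUpTo : ℕ → Cantor → Cantor → Set
AgreeUpTo m x y = ∀ i → i < m → x i ≡ y i

Continuous : (Cantor → Cantor) → Set
Continuous f = ∀ (x : Cantor) (n : ℕ) → ∃ λ m →
  ∀ (y : Cantor) → AgreeUpTo m x y → AgreeUpTo n (f x) (f y)

Subset : Set₁
Subset = Cantor → Set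

_⊆_ : Subset → Subset → Set
A ⊆ B = ∀ x → A x → B x

_⊊_ : Subset → Subset → Set
A ⊊ B = A ⊆ B × Σ Cantor (λ x → B x × (∀ a → A a → ¬ (x ≈ a)))

SquareCovered : (ℕ → Cantor → Cantor) → Subset → Set
SquareCovered F S = ∀ x y → S x → S y →
  ∃ λ n → (F n x ≈ y) ⊎ (F n y ≈ x)

MaximalCovered : (ℕ → Cantor → Cantor) → Subset → Set₁
MaximalCovered F S =
  SquareCovered F S × ¬ (Σ Subset λ S' → S ⊊ S' × SquareCovered F S')

-- S is countable: some ω-sequence enumerates (a superset of) S.
Countable : Subset → Set
Countable S = ∃ λ (e : ℕ → Cantor) → ∀ x → S x → ∃ λ n → e n ≈ x

Uncountable : Subset → Set
Uncountable S = ¬ Countable S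

-- Fix a pairing ⟪_,_⟫ : ℕ × ℕ → ℕ and
-- let F₀ = id and F₍ₖ₊₁₎(x) = (i ↦ x ⟪k+1 , i⟫), the (k+1)-st "row" of x.
-- Every F n only reindexes coordinates monotonically, hence is continuous.
-- Given any enumeration e of countably many points, the diagonal point z
-- whose (k+1)-st row is e k and whose entry at ⟪0 , k⟫ flips e k there is
-- different from every e k, is fixed by F₀ and is mapped onto e k by
-- F₍ₖ₊₁₎.  If a maximal covered set S were enumerated by e, then S ∪ {z}
-- would be a strictly larger set with covered square — a contradiction.
module Submission where

open import Defs
open import Data.Nat using (ℕ; zero; suc; _+_; _≤_; s≤s; z≤n)
open import Data.Nat.Properties
  using (+-suc; +-identityʳ; +-mono-≤; +-monoˡ-≤; +-monoʳ-≤; <⇒≤; n<1+n)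
open import Data.Product using (Σ; ∃; _×_; _,_; proj₁; proj₂)
open import Data.Sum using (_⊎_; inj₁; inj₂)
open import Data.Bool using (Bool; not)
open import Data.Bool.Properties using (not-¬)
open import Function using (_∘_; id)
open import Relation.Nullary using (¬_)
open import Relation.Binary.PropositionalEquality
  using (_≡_; refl; sym; trans; cong)
open Relation.Binary.PropositionalEquality.≡-Reasoning

≈-sym : ∀ {x y} → x ≈ y → y ≈ x
≈-sym x≈y i = sym (x≈y i)

≈-trans : ∀ {x y z} → x ≈ y → y ≈ z → x ≈ z
≈-trans x≈y y≈z i = trans (x≈y i) (y≈z i)

continuous-respects-≈ : ∀ {f} → Continuous f → ∀ {x y} → x ≈ y → f x ≈ f y
continuous-respects-≈ f-cont {x} {y} x≈y i =
  proj₂ (f-cont x (suc i)) y (λ j _ → x≈y j) i (n<1+n i)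

record Escapes (F : ℕ → Cantor → Cantor) (e : ℕ → Cantor) (z : Cantor) : Set where
  field
    distinct : ∀ k → ¬ (z ≈ e k)
    fixed    : ∃ λ n → F n z ≈ z
    reaches  : ∀ k → ∃ λ n → F n z ≈ e k

_∪｛_｝ : Subset → Cantor → Subset
(S ∪｛ z ｝) x = S x ⊎ (z ≈ x)

adjoin-covered : ∀ F S z → (∀ n → Continuous (F n)) → SquareCovered F S →
  (∃ λ n → F n z ≈ z) → (∀ x → S x → ∃ λ n → F n z ≈ x) →
  SquareCovered F (S ∪｛ z ｝)
adjoin-covered F S z F-cont S-cov (n₀ , fix) z↦S = covered
  where
  from-z : ∀ {w} x → S x → z ≈ w → ∃ λ n → F n w ≈ x
  from-z x Sx z≈w with z↦S x Sx
  ... | n , Fz≈x = n , ≈-trans (continuous-respects-≈ (F-cont n) (≈-sym z≈w)) Fz≈x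

  covered : SquareCovered F (S ∪｛ z ｝)
  covered x y (inj₁ Sx) (inj₁ Sy) = S-cov x y Sx Sy
  covered x y (inj₁ Sx) (inj₂ z≈y) with from-z x Sx z≈y
  ... | n , Fy≈x = n , inj₂ Fy≈x
  covered x y (inj₂ z≈x) (inj₁ Sy) with from-z y Sy z≈x
  ... | n , Fx≈y = n , inj₁ Fx≈y
  covered x y (inj₂ z≈x) (inj₂ z≈y) =
    n₀ , inj₁ (≈-trans (continuous-respects-≈ (F-cont n₀) (≈-sym z≈x))
                       (≈-trans fix z≈y))

-- If every enumeration has an escaping point, no maximal covered set is
-- countable: adjoining the escaping point of an enumeration of S would
-- strictly enlarge S while keeping its square covered.
escapes⇒maximal-uncountable : ∀ F → (∀ n → Continuous (F n)) →
  (∀ e → Σ Cantor (Escapes F e)) →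
  ∀ S → MaximalCovered F S → Uncountable S
escapes⇒maximal-uncountable F F-cont escape S (S-cov , S-max) (e , enum) =
  S-max (S ∪｛ z ｝ , (inj₁-⊆ , z , inj₂ (λ _ → refl) , z∉S) , covered)
  where
  open Escapes
  z = proj₁ (escape e)
  z-esc = proj₂ (escape e)

  inj₁-⊆ : S ⊆ (S ∪｛ z ｝)
  inj₁-⊆ _ = inj₁

  z∉S : ∀ a → S a → ¬ (z ≈ a)
  z∉S a Sa z≈a with enum a Sa
  ... | k , ek≈a = distinct z-esc k (≈-trans z≈a (≈-sym ek≈a))

  z↦S : ∀ x → S x → ∃ λ n → F n z ≈ x
  z↦S x Sx with enum x Sx
  ... | k , ek≈x with reaches z-esc k
  ...   | n , Fz≈ek = n , ≈-trans Fz≈ek ek≈x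

  covered : SquareCovered F (S ∪｛ z ｝)
  covered = adjoin-covered F S z F-cont S-cov (fixed z-esc) z↦S

triangle : ℕ → ℕ
triangle zero    = zero
triangle (suc s) = triangle s + suc s

-- ⟪ k , i ⟫ enumerates ℕ × ℕ along the anti-diagonals k + i = s, in order
-- of increasing k.
⟪_,_⟫ : ℕ → ℕ → ℕ
⟪ k , i ⟫ = triangle (k + i) + k

nextPair : ℕ × ℕ → ℕ × ℕ
nextPair (k , zero)  = zero , suc k
nextPair (k , suc i) = suc k , i

unpair : ℕ → ℕ × ℕ
unpair zero    = zero , zero
unpair (suc n) = nextPair (unpair n)

⟪0,suc⟫ : ∀ i → ⟪ zero , suc i ⟫ ≡ suc ⟪ i , zero ⟫
⟪0,suc⟫ i = begin
  triangle i + suc i + 0       ≡⟨ +-identityʳ _ ⟩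
  triangle i + suc i           ≡⟨ +-suc (triangle i) i ⟩
  suc (triangle i + i)         ≡⟨ cong (λ j → suc (triangle j + i)) (sym (+-identityʳ i)) ⟩
  suc (triangle (i + 0) + i)   ∎

⟪suc,_⟫ : ∀ k i → ⟪ suc k , i ⟫ ≡ suc ⟪ k , suc i ⟫
⟪suc, k ⟫ i = begin
  triangle (suc k + i) + suc k     ≡⟨ +-suc (triangle (suc k + i)) k ⟩
  suc (triangle (suc k + i) + k)   ≡⟨ cong (λ j → suc (triangle j + k)) (sym (+-suc k i)) ⟩
  suc (triangle (k + suc i) + k)   ∎

unpair-⟪⟫ : ∀ k i → unpair ⟪ k , i ⟫ ≡ (k , i)
unpair-⟪⟫ k i = along (k + i) k i refl
  where
  along : ∀ s k i → k + i ≡ s → unpair ⟪ k , i ⟫ ≡ (k , i)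
  along _        zero    zero    _    = refl
  along .(suc i) zero    (suc i) refl = begin
    unpair ⟪ zero , suc i ⟫        ≡⟨ cong unpair (⟪0,suc⟫ i) ⟩
    nextPair (unpair ⟪ i , zero ⟫) ≡⟨ cong nextPair (along i i zero (+-identityʳ i)) ⟩
    (zero , suc i)                 ∎
  along s        (suc k) i       k+i≡s = begin
    unpair ⟪ suc k , i ⟫            ≡⟨ cong unpair (⟪suc, k ⟫ i) ⟩
    nextPair (unpair ⟪ k , suc i ⟫) ≡⟨ cong nextPair (along s k (suc i) (trans (+-suc k i) k+i≡s)) ⟩
    (suc k , i)                     ∎

triangle-mono : ∀ {s t} → s ≤ t → triangle s ≤ triangle t
triangle-mono z≤n       = z≤n
triangle-mono (s≤s s≤t) = +-mono-≤ (triangle-mono s≤t) (s≤s s≤t)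

⟪⟫-monoʳ : ∀ k {i j} → i ≤ j → ⟪ k , i ⟫ ≤ ⟪ k , j ⟫
⟪⟫-monoʳ k i≤j = +-monoˡ-≤ k (triangle-mono (+-monoʳ-≤ k i≤j))

reindex : (ℕ → ℕ) → Cantor → Cantor
reindex g x = x ∘ g

-- Reindexing along a monotone g is continuous: the first n coordinates of
-- the image are determined by the first g n + 1 coordinates of the input.
reindex-continuous : ∀ g → (∀ {i j} → i ≤ j → g i ≤ g j) → Continuous (reindex g)
reindex-continuous g g-mono x n =
  suc (g n) , λ y agree i i<n → agree (g i) (s≤s (g-mono (<⇒≤ i<n)))

row : ℕ → ℕ → ℕ
row zero    = id
row (suc k) = ⟪ suc k ,_⟫

row-mono : ∀ n {i j} → i ≤ j → row n i ≤ row n j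
row-mono zero    i≤j = i≤j
row-mono (suc k) i≤j = ⟪⟫-monoʳ (suc k) i≤j

F : ℕ → Cantor → Cantor
F n = reindex (row n)

F-continuous : ∀ n → Continuous (F n)
F-continuous n = reindex-continuous (row n) (row-mono n)

diagonalAt : (ℕ → Cantor) → ℕ × ℕ → Bool
diagonalAt e (zero  , k) = not (e k ⟪ zero , k ⟫)
diagonalAt e (suc k , i) = e k i

diagonal : (ℕ → Cantor) → Cantor
diagonal e = diagonalAt e ∘ unpair

diagonal-escapes : ∀ e → Escapes F e (diagonal e)
diagonal-escapes e = record
  { distinct = λ k z≈ek → not-¬ (z≈ek ⟪ zero , k ⟫) (flips k)
  ; fixed    = zero , (λ _ → refl)
  ; reaches  = λ k → suc k , λ i → cong (diagonalAt e) (unpair-⟪⟫ (suc k) i)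
  }
  where
  flips : ∀ k → diagonal e ⟪ zero , k ⟫ ≡ not (e k ⟪ zero , k ⟫)
  flips k = cong (diagonalAt e) (unpair-⟪⟫ zero k)

theorem2p1 : Σ (ℕ → Cantor → Cantor) λ F →
    ((n : ℕ) → Continuous (F n)) ×
    ((S : Subset) → MaximalCovered F S → Uncountable S)
theorem2p1 =
  F , F-continuous ,
  escapes⇒maximal-uncountable F F-continuous (λ e → diagonal e , diagonal-escapes e)
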